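{- For every integer $n \geq 3$ there is a deterministic finite automaton $P_n$ over a group alphabet $\Sigma$ with $|\Sigma| = 2n$, having $n+2$ states and $2n$ edges, such that there is exactly one word $w \in L(P_n)$ with $r(w) = \varepsilon$, and this word has length $|w| = 2^n$.
   Context: A group alphabet is $\Sigma = \Gamma \cup \overline{\Gamma}$ where $\Gamma = \{1,\dots,m\}$ and $\overline{\Gamma} = \{\overline{1},\dots,\overline{m}\}$ consists of formal inverse letters ($\overline{\overline{a}} = a$). For $w \in \Sigma^*$, $r(w)$ denotes the reduced representation of $w$: the unique word obtained from $w$ by repeatedly deleting factors of the form $a\overline{a}$ with $a \in \Sigma$ until no such factor remains; $\varepsilon$ is the empty word. A deterministic finite automaton is $(Q,\Sigma,\delta,q_0,F)$ with partial transition function $\delta$, and $L(P_n)$ is the set of words it accepts. -}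

module Defs where

open import Data.Nat using (ℕ; zero; suc; _+_)
open import Data.Fin using (Fin)
open import Data.Fin.Base using ()
open import Data.List using (List; []; _∷_; _++_; map)
open import Data.Nat.ListAction using (sum)
open import Data.Empty using (⊥)
open import Data.List using (allFin) public
open import Data.Maybe using (Maybe; just; nothing; is-just)
open import Data.Bool using (Bool; true; false; if_then_else_)
open import Relation.Binary.PropositionalEquality using (_≡_)
open import Relation.Binary.Construct.Closure.ReflexiveTransitive using (Star)
open import Data.Product using (_×_)

-- Group alphabet Σ = Γ ∪ Γ̄ with Γ = {1..m}: letters a and formal inverses ā.
data Sym (m : ℕ) : Set where
  pos : Fin m → Sym m
  neg : Fin m → Sym m

inv : ∀ {m} → Sym m → Sym m
inv (pos i) = neg i
inv (neg i) = pos i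

allSym : (m : ℕ) → List (Sym m)
allSym m = map pos (allFin m) ++ map neg (allFin m)

Word : ℕ → Set
Word m = List (Sym m)

data _⟶_ {m : ℕ} : Word m → Word m → Set where
  del : (u v : Word m) (a : Sym m) → (u ++ a ∷ inv a ∷ v) ⟶ (u ++ v)

-- r(w) = ε : w reduces to the empty word by repeatedly deleting factors a ā
-- (the reduced representation is unique, so this is exactly r(w) ≡ ε)
ReducesToε : ∀ {m} → Word m → Set
ReducesToε w = Star _⟶_ w []

record DFA (m k : ℕ) : Set where
  field
    δ  : Fin k → Sym m → Maybe (Fin k)
    q₀ : Fin k
    F  : Fin k → Bool

  δ* : Fin k → Word m → Maybe (Fin k)
  δ* q [] = just q
  δ* q (a ∷ w) with δ q a
  ... | just q' = δ* q' w
  ... | nothing = nothing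

  Accepts : Word m → Set
  Accepts w with δ* q₀ w
  ... | just q = F q ≡ true
  ... | nothing = ⊥

  edges : ℕ
  edges = sum (map (λ q → sum (map (λ a → if is-just (δ q a) then 1 else 0) (allSym m))) (allFin k))

-- A word reduces to ε iff it is balanced: empty, or a X ā Y with X and Y balanced.
-- In Pₙ every letter a labels a single edge src a → tgt a between the states 0, …, n+1; call a
-- an opener when tgt a ≤ src ā. Every opener satisfies src a < tgt ā, so by induction on
-- balanced words a balanced path never decreases the state, and strictly increases it unless
-- it is empty. Hence every nonempty balanced path a X ā Y starts with an opener; the openers
-- are the positive letters, one for each source state, so a X ā Y is determined by the
-- endpoints of its path, and X and Y by induction.
-- The accepted balanced word is 0 0̄ T(n-2), where T(0) = (n-1)(n-1)‾ and
-- T(d+1) = ℓ T(d) ℓ̄ T(d) with ℓ = n-2-d, so that |T(d)| + 2 = 2^(d+2).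
module Submission where

open import Defs
open import Data.Bool using (Bool; true; false; if_then_else_)
open import Data.Bool.Properties using (T-≡)
open import Data.Empty using (⊥-elim)
open import Data.Fin using (Fin; toℕ; fromℕ<) renaming (zero to fzero; suc to fsuc)
open import Data.Fin.Properties using (toℕ-fromℕ<; toℕ<n; toℕ-injective)
open import Data.List using (List; []; _∷_; _++_; map; tabulate; length; allFin)
open import Data.List.Properties using (++-assoc; ∷-injective; map-cong; map-tabulate; length-map; length-tabulate; length-++)
open import Data.Maybe using (just; nothing; is-just)
open import Data.Nat using (ℕ; zero; suc; _+_; _*_; _^_; _∸_; _≤_; _<_; s≤s; z≤n; _≡ᵇ_)
open import Data.Nat.ListAction using (sum)
open import Data.Nat.Properties
  using ( ≤-refl; ≤-reflexive; ≤-trans; <⇒≤; <-≤-trans; <-irrefl; <⇒≱; n<1+n; n≤1+n; m<n⇒m<1+n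
        ; +-comm; +-identityʳ; +-commutativeSemigroup; m∸n≤m; ∸-monoʳ-<; +-∸-assoc; n∸n≡0
        ; ≡ᵇ⇒≡; ≡⇒≡ᵇ )
open import Algebra.Properties.CommutativeSemigroup +-commutativeSemigroup using (interchange)
open import Data.Nat.Tactic.RingSolver using (solve-∀)
open import Data.Product using (Σ; ∃; _×_; _,_)
open import Data.Sum using (_⊎_; inj₁; inj₂)
open import Function using (id; _∘_; _⇔_; mk⇔; Equivalence)
open import Relation.Nullary using (¬_)
open import Relation.Binary.PropositionalEquality
open import Relation.Binary.Construct.Closure.ReflexiveTransitive using (ε; _◅_; _◅◅_; gmap)

++-≡-++ : ∀ {A : Set} (xs : List A) {z ys} us {vs} → xs ++ z ∷ ys ≡ us ++ vs →
  (∃ λ rs → xs ≡ us ++ rs × vs ≡ rs ++ z ∷ ys) ⊎ (∃ λ rs → us ≡ xs ++ z ∷ rs × ys ≡ rs ++ vs)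
++-≡-++ xs       []       refl = inj₁ (xs , refl , refl)
++-≡-++ []       (u ∷ us) refl = inj₂ (us , refl , refl)
++-≡-++ (x ∷ xs) (u ∷ us) eq with refl , eq′ ← ∷-injective eq with ++-≡-++ xs us eq′
... | inj₁ (rs , refl , vs≡) = inj₁ (rs , refl , vs≡)
... | inj₂ (rs , refl , ys≡) = inj₂ (rs , refl , ys≡)

module _ {m : ℕ} where
  data Balanced : Word m → Set where
    []   : Balanced []
    wrap : ∀ a {X Y} → Balanced X → Balanced Y → Balanced (a ∷ X ++ inv a ∷ Y)

  ⟶-∷ : ∀ x {u v : Word m} → u ⟶ v → (x ∷ u) ⟶ (x ∷ v)
  ⟶-∷ x (del u v a) = del (x ∷ u) v a

  ⟶-++ʳ : ∀ s {u v : Word m} → u ⟶ v → (u ++ s) ⟶ (v ++ s)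
  ⟶-++ʳ s (del u v a) =
    subst₂ _⟶_ (sym (++-assoc u _ s)) (sym (++-assoc u v s)) (del u (v ++ s) a)

  balanced⇒reducesToε : ∀ {w} → Balanced w → ReducesToε w
  balanced⇒reducesToε [] = ε
  balanced⇒reducesToε (wrap a {X} {Y} bX bY) =
    gmap (λ u → a ∷ u ++ inv a ∷ Y) (⟶-∷ a ∘ ⟶-++ʳ (inv a ∷ Y)) (balanced⇒reducesToε bX)
      ◅◅ del [] Y a ◅ balanced⇒reducesToε bY

  balanced-insert : ∀ u {v w} a → Balanced w → w ≡ u ++ v → Balanced (u ++ a ∷ inv a ∷ v)
  balanced-insert [] a b refl = wrap a [] b
  balanced-insert (x ∷ u) a (wrap b {X} {Y} bX bY) eq
    with refl , eq′ ← ∷-injective eq with ++-≡-++ X u eq′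
  ... | inj₁ (rs , refl , refl) =
    subst Balanced (cong (b ∷_) (++-assoc u _ _)) (wrap b (balanced-insert u a bX refl) bY)
  ... | inj₂ (rs , refl , refl) =
    subst Balanced (cong (b ∷_) (sym (++-assoc X _ _))) (wrap b bX (balanced-insert rs a bY refl))

  reducesToε⇒balanced : ∀ {w} → ReducesToε w → Balanced w
  reducesToε⇒balanced ε = []
  reducesToε⇒balanced (del u v a ◅ r) = balanced-insert u a (reducesToε⇒balanced r) refl

module LetterGraph {m : ℕ} (src tgt : Sym m → ℕ) where

  Path : ℕ → Word m → ℕ → Set
  Path p []      q = p ≡ q
  Path p (a ∷ w) q = src a ≡ p × Path (tgt a) w q

  Path-++ : ∀ u {v p e q} → Path p u e → Path e v q → Path p (u ++ v) q
  Path-++ []      refl        πv = πv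
  Path-++ (a ∷ u) (sa , πu)   πv = sa , Path-++ u πu πv

  Path-++⁻ : ∀ u {v p q} → Path p (u ++ v) q → ∃ λ e → Path p u e × Path e v q
  Path-++⁻ []      π        = _ , refl , π
  Path-++⁻ (a ∷ u) (sa , π) with e , πu , πv ← Path-++⁻ u π = e , (sa , πu) , πv

  Path-wrap : ∀ a X {Y p q} → src a ≡ p → Path (tgt a) X (src (inv a)) → Path (tgt (inv a)) Y q →
              Path p (a ∷ X ++ inv a ∷ Y) q
  Path-wrap a X sa πX πY = sa , Path-++ X πX (refl , πY)

  Path-wrap⁻ : ∀ a X {Y p q} → Path p (a ∷ X ++ inv a ∷ Y) q →
               src a ≡ p × Path (tgt a) X (src (inv a)) × Path (tgt (inv a)) Y q
  Path-wrap⁻ a X (sa , π) with _ , πX , (refl , πY) ← Path-++⁻ X π = sa , πX , πY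

  Opener : Sym m → Set
  Opener a = tgt a ≤ src (inv a)

  module Monotone (opener-climbs : ∀ a → Opener a → src a < tgt (inv a)) where

    balanced-path-≤ : ∀ {w p q} → Balanced w → Path p w q → p ≤ q
    balanced-path-< : ∀ a {X Y p q} → Balanced X → Balanced Y → Path p (a ∷ X ++ inv a ∷ Y) q → p < q

    balanced-path-≤ []             refl = ≤-refl
    balanced-path-≤ (wrap a bX bY) π    = <⇒≤ (balanced-path-< a bX bY π)

    balanced-path-< a {X} bX bY π with refl , πX , πY ← Path-wrap⁻ a X π =
      <-≤-trans (opener-climbs a (balanced-path-≤ bX πX)) (balanced-path-≤ bY πY)

    module Unique (opener-src-injective : ∀ a b → Opener a → Opener b → src a ≡ src b → a ≡ b) where

      balanced-path-unique : ∀ {w w′ p q} → Balanced w → Balanced w′ →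
                             Path p w q → Path p w′ q → w ≡ w′
      balanced-path-unique []             []             _    _    = refl
      balanced-path-unique []             (wrap b bX bY) refl π′   = ⊥-elim (<-irrefl refl (balanced-path-< b bX bY π′))
      balanced-path-unique (wrap a bX bY) []             π    refl = ⊥-elim (<-irrefl refl (balanced-path-< a bX bY π))
      balanced-path-unique (wrap a {X} bX bY) (wrap b {X′} bX′ bY′) π π′
        with refl , πX , πY ← Path-wrap⁻ a X π
           | sb , πX′ , πY′ ← Path-wrap⁻ b X′ π′
        with refl ← opener-src-injective a b (balanced-path-≤ bX πX) (balanced-path-≤ bX′ πX′) (sym sb) =
        cong₂ (λ X Y → a ∷ X ++ inv a ∷ Y)
              (balanced-path-unique bX bX′ πX πX′) (balanced-path-unique bY bY′ πY πY′)

indicator : Bool → ℕ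
indicator b = if b then 1 else 0

sum-map-+ : ∀ {A : Set} (f g : A → ℕ) xs → sum (map (λ x → f x + g x) xs) ≡ sum (map f xs) + sum (map g xs)
sum-map-+ f g []       = refl
sum-map-+ f g (x ∷ xs) = trans (cong (f x + g x +_) (sum-map-+ f g xs)) (interchange (f x) (g x) _ _)

sum-map-0 : ∀ {A : Set} (xs : List A) → sum (map (λ _ → 0) xs) ≡ 0
sum-map-0 []       = refl
sum-map-0 (x ∷ xs) = sum-map-0 xs

sum-map-swap : ∀ {A B : Set} (f : A → B → ℕ) xs ys →
  sum (map (λ x → sum (map (f x) ys)) xs) ≡ sum (map (λ y → sum (map (λ x → f x y) xs)) ys)
sum-map-swap f []       ys = sym (sum-map-0 ys)
sum-map-swap f (x ∷ xs) ys = trans (cong (sum (map (f x) ys) +_) (sum-map-swap f xs ys))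
                                   (sym (sum-map-+ (f x) _ ys))

sum-map-1 : ∀ {A : Set} (f : A → ℕ) xs → (∀ x → f x ≡ 1) → sum (map f xs) ≡ length xs
sum-map-1 f []       f≡1 = refl
sum-map-1 f (x ∷ xs) f≡1 = cong₂ _+_ (f≡1 x) (sum-map-1 f xs f≡1)

count-tabulate : ∀ k c → c < k → sum (tabulate {n = k} (λ q → indicator (toℕ q ≡ᵇ c))) ≡ 1
count-tabulate (suc k) zero    _         = cong suc (trans (cong sum (sym (map-tabulate {n = k} id (λ _ → 0))))
                                                           (sum-map-0 (tabulate {n = k} id)))
count-tabulate (suc k) (suc c) (s≤s c<k) = count-tabulate k c c<k

count-allFin : ∀ k c → c < k → sum (map (λ q → indicator (toℕ q ≡ᵇ c)) (allFin k)) ≡ 1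
count-allFin k c c<k = trans (cong sum (map-tabulate {n = k} id _)) (count-tabulate k c c<k)

length-allSym : ∀ m → length (allSym m) ≡ 2 * m
length-allSym m = begin
  length (map pos (allFin m) ++ map neg (allFin m))          ≡⟨ length-++ (map pos (allFin m)) ⟩
  length (map pos (allFin m)) + length (map neg (allFin m))  ≡⟨ cong₂ _+_ (length-allFin pos) (length-allFin neg) ⟩
  m + m                                                      ≡⟨ cong (m +_) (sym (+-identityʳ m)) ⟩
  2 * m                                                      ∎
  where
  open ≡-Reasoning
  length-allFin : (f : Fin m → Sym m) → length (map f (allFin m)) ≡ m
  length-allFin f = trans (length-map f (allFin m)) (length-tabulate {n = m} id)

is-just-if : ∀ {A : Set} b (x : A) → indicator (is-just (if b then just x else nothing)) ≡ indicator b
is-just-if true  x = refl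
is-just-if false x = refl

module LetterAutomaton {m k : ℕ} (src tgt : Sym m → ℕ) (tgt< : ∀ a → tgt a < k) (start : Fin k) (final : ℕ) where
  open LetterGraph src tgt

  automaton : DFA m k
  automaton = record
    { δ  = λ q a → if toℕ q ≡ᵇ src a then just (fromℕ< (tgt< a)) else nothing
    ; q₀ = start
    ; F  = λ q → toℕ q ≡ᵇ final
    }

  open DFA automaton using (δ*; Accepts; edges)

  δ*⇒Path : ∀ q w {q′} → δ* q w ≡ just q′ → Path (toℕ q) w (toℕ q′)
  δ*⇒Path q []      refl = refl
  δ*⇒Path q (a ∷ w) eq with toℕ q ≡ᵇ src a | ≡ᵇ⇒≡ (toℕ q) (src a)
  ... | true | q≡ = sym (q≡ _) , subst (λ p → Path p w _) (toℕ-fromℕ< (tgt< a)) (δ*⇒Path _ w eq)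

  Path⇒δ* : ∀ q w {p} → Path (toℕ q) w p → ∃ λ q′ → δ* q w ≡ just q′ × toℕ q′ ≡ p
  Path⇒δ* q []      refl     = q , refl , refl
  Path⇒δ* q (a ∷ w) (sa , π) with toℕ q ≡ᵇ src a | ≡⇒≡ᵇ (toℕ q) (src a) (sym sa)
  ... | true | _ = Path⇒δ* _ w (subst (λ p → Path p w _) (sym (toℕ-fromℕ< (tgt< a))) π)

  accepts⇔Path : ∀ w → Accepts w ⇔ Path (toℕ start) w final
  accepts⇔Path w = mk⇔ to from
    where
    to : Accepts w → Path (toℕ start) w final
    to acc with δ* start w in eq
    ... | just q = subst (Path (toℕ start) w) (≡ᵇ⇒≡ _ _ (Equivalence.from T-≡ acc)) (δ*⇒Path start w eq)
    from : Path (toℕ start) w final → Accepts w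
    from π with Path⇒δ* start w π
    ... | q , eq , q≡ rewrite eq = Equivalence.to T-≡ (≡⇒≡ᵇ _ _ q≡)

  edges≡ : (∀ a → src a < k) → edges ≡ 2 * m
  edges≡ src< = begin
    edges
      ≡⟨ cong sum (map-cong (λ q → cong sum (map-cong (λ a → is-just-if (toℕ q ≡ᵇ src a) _) (allSym m))) (allFin k)) ⟩
    sum (map (λ q → sum (map (λ a → indicator (toℕ q ≡ᵇ src a)) (allSym m))) (allFin k))
      ≡⟨ sum-map-swap (λ q a → indicator (toℕ q ≡ᵇ src a)) (allFin k) (allSym m) ⟩
    sum (map (λ a → sum (map (λ q → indicator (toℕ q ≡ᵇ src a)) (allFin k))) (allSym m))
      ≡⟨ sum-map-1 _ (allSym m) (λ a → count-allFin k (src a) (src< a)) ⟩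
    length (allSym m)
      ≡⟨ length-allSym m ⟩
    2 * m ∎
    where open ≡-Reasoning

-- Pₙ for n = 2 + k, with letters numbered from 0: pos 0 is a loop at 0, neg 0 : 0 → 1,
-- pos j : j → j+1 for j ≥ 1, the last letter has neg (n-1) : n → n+1, and every middle
-- letter has neg j : n+1 → j+1. The start state is 0 and the final state is n+1.
module Ladder (k : ℕ) where

  n : ℕ
  n = suc (suc k)

  src : Sym n → ℕ
  src (pos j)        = toℕ j
  src (neg fzero)    = 0
  src (neg (fsuc i)) = if toℕ i ≡ᵇ k then n else suc n

  tgt : Sym n → ℕ
  tgt (pos fzero)    = 0
  tgt (pos (fsuc i)) = suc (suc (toℕ i))
  tgt (neg fzero)    = 1
  tgt (neg (fsuc i)) = if toℕ i ≡ᵇ k then suc n else suc (suc (toℕ i))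

  open LetterGraph src tgt

  toℕ<tgt-neg : ∀ j → toℕ j < tgt (neg j)
  toℕ<tgt-neg fzero    = s≤s z≤n
  toℕ<tgt-neg (fsuc i) with toℕ i ≡ᵇ k
  ... | true  = s≤s (m<n⇒m<1+n (toℕ<n i))
  ... | false = n<1+n _

  neg-not-opener : ∀ j → ¬ Opener (neg j)
  neg-not-opener j = <⇒≱ (toℕ<tgt-neg j)

  opener-climbs : ∀ a → Opener a → src a < tgt (inv a)
  opener-climbs (pos j) _  = toℕ<tgt-neg j
  opener-climbs (neg j) op = ⊥-elim (neg-not-opener j op)

  opener-src-injective : ∀ a b → Opener a → Opener b → src a ≡ src b → a ≡ b
  opener-src-injective (pos i) (pos j) _  _  e = cong pos (toℕ-injective e)
  opener-src-injective (neg i) _       op _  _ = ⊥-elim (neg-not-opener i op)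
  opener-src-injective _       (neg j) _  op _ = ⊥-elim (neg-not-opener j op)

  open Monotone opener-climbs
  open Unique opener-src-injective

  ≤suc-n⇒<n+2 : ∀ {p} → p ≤ suc n → p < n + 2
  ≤suc-n⇒<n+2 p≤ = ≤-trans (s≤s p≤) (≤-reflexive (+-comm 2 n))

  src≤ : ∀ a → src a ≤ suc n
  src≤ (pos j)        = ≤-trans (<⇒≤ (toℕ<n j)) (n≤1+n n)
  src≤ (neg fzero)    = z≤n
  src≤ (neg (fsuc i)) with toℕ i ≡ᵇ k
  ... | true  = n≤1+n n
  ... | false = ≤-refl

  tgt≤ : ∀ a → tgt a ≤ suc n
  tgt≤ (pos fzero)    = z≤n
  tgt≤ (pos (fsuc i)) = s≤s (s≤s (<⇒≤ (toℕ<n i)))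
  tgt≤ (neg fzero)    = s≤s z≤n
  tgt≤ (neg (fsuc i)) with toℕ i ≡ᵇ k
  ... | true  = ≤-refl
  ... | false = s≤s (s≤s (<⇒≤ (toℕ<n i)))

  neg-last : ∀ i → toℕ i ≡ k → src (neg (fsuc i)) ≡ n × tgt (neg (fsuc i)) ≡ suc n
  neg-last i i≡k with toℕ i ≡ᵇ k | ≡⇒≡ᵇ (toℕ i) k i≡k
  ... | true | _ = refl , refl

  neg-middle : ∀ i → toℕ i < k → src (neg (fsuc i)) ≡ suc n × tgt (neg (fsuc i)) ≡ suc (suc (toℕ i))
  neg-middle i i<k with toℕ i ≡ᵇ k | ≡ᵇ⇒≡ (toℕ i) k
  ... | false | _   = refl , refl
  ... | true  | i≡k = ⊥-elim (<-irrefl (i≡k _) i<k)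

  rung : ℕ → Fin (suc k)
  rung d = fromℕ< (s≤s (m∸n≤m k d))

  toℕ-rung : ∀ d → toℕ (rung d) ≡ k ∸ d
  toℕ-rung d = toℕ-fromℕ< (s≤s (m∸n≤m k d))

  rung-suc<k : ∀ d → d < k → toℕ (rung (suc d)) < k
  rung-suc<k d d<k = subst (_< k) (sym (toℕ-rung (suc d))) (∸-monoʳ-< (s≤s z≤n) d<k)

  suc-rung-suc : ∀ d → d < k → suc (toℕ (rung (suc d))) ≡ k ∸ d
  suc-rung-suc d d<k = trans (cong suc (toℕ-rung (suc d))) (sym (+-∸-assoc 1 d<k))

  tower : ℕ → Word n
  tower zero    = pos (fsuc (rung 0)) ∷ neg (fsuc (rung 0)) ∷ []
  tower (suc d) = pos (fsuc (rung (suc d))) ∷ tower d ++ neg (fsuc (rung (suc d))) ∷ tower d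

  word : Word n
  word = pos fzero ∷ neg fzero ∷ tower k

  tower-balanced : ∀ d → Balanced (tower d)
  tower-balanced zero    = wrap _ [] []
  tower-balanced (suc d) = wrap _ (tower-balanced d) (tower-balanced d)

  word-balanced : Balanced word
  word-balanced = wrap (pos fzero) [] (tower-balanced k)

  tower-path : ∀ d → d ≤ k → Path (suc (k ∸ d)) (tower d) (suc n)
  tower-path zero    _ with src-neg , tgt-neg ← neg-last (rung 0) (toℕ-rung 0) =
    Path-wrap (pos (fsuc (rung 0))) [] (cong suc (toℕ-rung 0))
      (trans (cong (suc ∘ suc) (toℕ-rung 0)) (sym src-neg)) tgt-neg
  tower-path (suc d) d<k with src-neg , tgt-neg ← neg-middle (rung (suc d)) (rung-suc<k d d<k) =
    Path-wrap (pos (fsuc (rung (suc d)))) (tower d) (cong suc (toℕ-rung (suc d)))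
      (subst₂ (λ p q → Path p (tower d) q) (sym climb) (sym src-neg) (tower-path d (<⇒≤ d<k)))
      (subst (λ p → Path p (tower d) (suc n)) (sym (trans tgt-neg climb)) (tower-path d (<⇒≤ d<k)))
    where
    climb : suc (suc (toℕ (rung (suc d)))) ≡ suc (k ∸ d)
    climb = cong suc (suc-rung-suc d d<k)

  word-path : Path 0 word (suc n)
  word-path = refl , refl , subst (λ p → Path (suc p) (tower k) (suc n)) (n∸n≡0 k) (tower-path k ≤-refl)

  length-tower : ∀ d → 2 + length (tower d) ≡ 2 ^ (2 + d)
  length-tower zero    = refl
  length-tower (suc d) = begin
    3 + length (tower d ++ _ ∷ tower d) ≡⟨ cong (3 +_) (length-++ (tower d)) ⟩
    3 + (l + suc l)                     ≡⟨ doubling l ⟩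
    2 * (2 + l)                         ≡⟨ cong (2 *_) (length-tower d) ⟩
    2 ^ (3 + d)                         ∎
    where
    open ≡-Reasoning
    l = length (tower d)
    doubling : ∀ l → 3 + (l + suc l) ≡ 2 * (2 + l)
    doubling = solve-∀

  word-unique : ∀ {w} → Balanced w → Path 0 w (suc n) → w ≡ word
  word-unique bw π = balanced-path-unique bw word-balanced π word-path

  open LetterAutomaton src tgt (λ a → ≤suc-n⇒<n+2 (tgt≤ a)) fzero (suc n) public

lemma2 : (n : ℕ) → 3 ≤ n →
    Σ (DFA n (n + 2)) λ P →
      (DFA.edges P ≡ 2 * n) ×
      (∃ λ w → (DFA.Accepts P w × ReducesToε w)
             × (∀ w′ → DFA.Accepts P w′ → ReducesToε w′ → w′ ≡ w)
             × (length w ≡ 2 ^ n))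
lemma2 zero          ()
lemma2 (suc zero)    (s≤s ())
-- The construction already works for n = 2.
lemma2 (suc (suc k)) _ =
  automaton , edges≡ (λ a → ≤suc-n⇒<n+2 (src≤ a)) ,
  word , (Equivalence.from (accepts⇔Path word) word-path , balanced⇒reducesToε word-balanced) ,
  unique , length-tower k
  where
  open Ladder k
  unique : ∀ w′ → DFA.Accepts automaton w′ → ReducesToε w′ → w′ ≡ word
  unique w′ acc r = word-unique (reducesToε⇒balanced r) (Equivalence.to (accepts⇔Path w′) acc)
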